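{- Let $L$ be a complete atomistic Boolean lattice and let $T$ be a t-norm on $L$. Then $T$ is left-semicontinuous if and only if $T\in\mathfrak{T}(L)$, where $\mathfrak{T}(L)=\{\overline{T'}\mid T' \text{ a t-norm on } C(L)\}$ and $\overline{T'}(x,y)=\bigvee_{u\in\kappa(x)}\bigvee_{v\in\kappa(y)}T'(u,v)$ with $\kappa(x)=\{u\in C(L)\setminus\{0\}\mid u\le x\}$.
   Context: A lattice $L$ with bottom $0$ and top $1$ is atomistic if every element is a join of atoms (elements covering $0$); $A(L)$ is the set of atoms and $C(L)=A(L)\cup\{0,1\}$ has the order inherited from $L$. A t-norm on a bounded poset with top $1$ is a binary operation that is monotone in each argument, commutative, associative, with neutral element $1$. A t-norm $T$ on a complete lattice $L$ is left-semicontinuous if $T(a,\bigvee S)=\bigvee_{x\in S}T(a,x)$ for every $a\in L$ and every $S\subseteq L$ with $\bigvee S\ne 1$. -}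

module Defs where

open import Level using (Level; _⊔_; Lift) renaming (suc to lsuc)
open import Data.Empty using (⊥)
open import Data.Unit using (⊤)
open import Data.Product using (Σ; ∃; _×_; _,_; proj₁)
open import Data.Sum using (_⊎_)
open import Relation.Nullary using (¬_)
open import Relation.Unary using (Pred; _∈_)
open import Relation.Binary.Core using (Rel)
open import Relation.Binary.Structures using (IsPartialOrder)
open import Relation.Binary.PropositionalEquality using (_≡_)

record CompleteLattice (a : Level) : Set (lsuc a) where
  field
    Carrier        : Set a
    _≤_            : Rel Carrier a
    isPartialOrder : IsPartialOrder _≡_ _≤_
    ⋁              : Pred Carrier a → Carrier
    ⋁-upper        : (S : Pred Carrier a) (x : Carrier) → x ∈ S → x ≤ ⋁ S
    ⋁-least        : (S : Pred Carrier a) (y : Carrier) →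
                     ((x : Carrier) → x ∈ S → x ≤ y) → ⋁ S ≤ y

  𝟘 : Carrier
  𝟘 = ⋁ (λ _ → Lift a ⊥)

  𝟙 : Carrier
  𝟙 = ⋁ (λ _ → Lift a ⊤)

  _∨_ : Carrier → Carrier → Carrier
  x ∨ y = ⋁ (λ z → (z ≡ x) ⊎ (z ≡ y))

  _∧_ : Carrier → Carrier → Carrier
  x ∧ y = ⋁ (λ z → (z ≤ x) × (z ≤ y))

  IsBoolean : Set a
  IsBoolean =
    ((x y z : Carrier) → (x ∧ (y ∨ z)) ≡ ((x ∧ y) ∨ (x ∧ z))) ×
    ((x : Carrier) → ∃ λ y → ((x ∧ y) ≡ 𝟘) × ((x ∨ y) ≡ 𝟙))

  IsAtom : Pred Carrier a
  IsAtom p = (𝟘 ≤ p) × ¬ (p ≡ 𝟘) ×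
             ((z : Carrier) → 𝟘 ≤ z → z ≤ p → (z ≡ 𝟘) ⊎ (z ≡ p))

  IsAtomistic : Set (lsuc a)
  IsAtomistic = (x : Carrier) →
    ∃ λ (S : Pred Carrier a) → ((p : Carrier) → p ∈ S → IsAtom p) × (x ≡ ⋁ S)

  -- C(L) = A(L) ∪ {0,1}, as a subtype with the inherited order
  InC : Pred Carrier a
  InC x = IsAtom x ⊎ (x ≡ 𝟘) ⊎ (x ≡ 𝟙)

  C : Set a
  C = Σ Carrier InC

  _≈C_ : Rel C a
  u ≈C v = proj₁ u ≡ proj₁ v

  _≤C_ : Rel C a
  u ≤C v = proj₁ u ≤ proj₁ v

  𝟙C : C
  𝟙C = 𝟙 , _⊎_.inj₂ (_⊎_.inj₂ _≡_.refl)

record IsTNorm {a ℓ₁ ℓ₂ : Level} {A : Set a}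
               (_≈_ : Rel A ℓ₁) (_≤_ : Rel A ℓ₂) (⊤ : A)
               (T : A → A → A) : Set (a ⊔ ℓ₁ ⊔ ℓ₂) where
  field
    monoˡ    : ∀ {x y} z → x ≤ y → T x z ≤ T y z
    monoʳ    : ∀ {x y} z → x ≤ y → T z x ≤ T z y
    comm     : ∀ x y → T x y ≈ T y x
    assoc    : ∀ x y z → T (T x y) z ≈ T x (T y z)
    identityʳ : ∀ x → T x ⊤ ≈ x

module _ {a : Level} (L : CompleteLattice a) where
  open CompleteLattice L

  IsTNormL : (Carrier → Carrier → Carrier) → Set a
  IsTNormL = IsTNorm _≡_ _≤_ 𝟙

  IsTNormC : (C → C → C) → Set a
  IsTNormC = IsTNorm _≈C_ _≤C_ 𝟙C

  κ : Carrier → Pred C a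
  κ x u = ¬ (proj₁ u ≡ 𝟘) × (proj₁ u ≤ x)

  extend : (C → C → C) → Carrier → Carrier → Carrier
  extend T' x y =
    ⋁ (λ z → ∃ λ (u : C) → u ∈ κ x ×
         (z ≡ ⋁ (λ w → ∃ λ (v : C) → v ∈ κ y × (w ≡ proj₁ (T' u v)))))

  In𝔗 : (Carrier → Carrier → Carrier) → Set a
  In𝔗 T = ∃ λ (T' : C → C → C) → IsTNormC T' ×
            ((x y : Carrier) → T x y ≡ extend T' x y)

  LeftSemicontinuous : (Carrier → Carrier → Carrier) → Set (lsuc a)
  LeftSemicontinuous T = (x : Carrier) (S : Pred Carrier a) → ¬ (⋁ S ≡ 𝟙) →
    T x (⋁ S) ≡ ⋁ (λ z → ∃ λ (y : Carrier) → y ∈ S × (z ≡ T x y))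

{-# OPTIONS --safe #-}
-- Both directions rest on two facts about a complete atomistic lattice: every
-- element is the join of the atoms below it, and an atom p is either below an
-- element e or disjoint from it, so w ≤ e is decided atom by atom and is
-- therefore ¬¬-stable, which licenses classical case distinctions when
-- proving inequalities.
-- A t-norm T maps C(L) × C(L) into C(L), since T(p, v) ≤ p for an atom p, and
-- left-semicontinuity lets T be recovered from this restriction by splitting
-- both arguments into atoms. Conversely, in a Boolean lattice an atom below a
-- join ⋁ S ≠ 1 lies below some member of S, which makes every extension
-- T̄' left-semicontinuous.
module Submission where

open import Defs
open import Level using (Level; lift)
open import Function.Bundles using (_⇔_; mk⇔)
open import Data.Unit using (tt)
open import Data.Product using (∃; _×_; _,_; proj₁; proj₂)
open import Data.Sum using (_⊎_; inj₁; inj₂)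
open import Relation.Nullary using (¬_; yes; no)
open import Relation.Nullary.Negation using (Stable; ¬¬-map; contradiction)
open import Relation.Nullary.Decidable.Core using (¬¬-excluded-middle)
open import Relation.Unary using (Pred; _∈_)
open import Relation.Binary.Bundles using (Poset)
open import Relation.Binary.PropositionalEquality using (_≡_; refl; sym; trans; subst; cong)

module _ {a : Level} (L : CompleteLattice a) where
  open CompleteLattice L

  poset : Poset a a a
  poset = record { isPartialOrder = isPartialOrder }

  open Poset poset using (antisym)
    renaming (refl to ≤-refl; reflexive to ≤-reflexive; trans to ≤-trans)
  open import Relation.Binary.Reasoning.PartialOrder poset

  𝟘-least : ∀ x → 𝟘 ≤ x
  𝟘-least x = ⋁-least _ x (λ { _ (lift ()) })

  𝟙-greatest : ∀ x → x ≤ 𝟙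
  𝟙-greatest x = ⋁-upper _ x (lift tt)

  ≤𝟘⇒≡𝟘 : ∀ {x} → x ≤ 𝟘 → x ≡ 𝟘
  ≤𝟘⇒≡𝟘 x≤𝟘 = antisym x≤𝟘 (𝟘-least _)

  𝟙≡𝟘⇒≤ : 𝟙 ≡ 𝟘 → ∀ x y → x ≤ y
  𝟙≡𝟘⇒≤ 𝟙≡𝟘 x y = ≤-trans (𝟙-greatest x) (≤-trans (≤-reflexive 𝟙≡𝟘) (𝟘-least y))

  x∧y≤x : ∀ x y → (x ∧ y) ≤ x
  x∧y≤x x y = ⋁-least _ x (λ _ → proj₁)

  x∧y≤y : ∀ x y → (x ∧ y) ≤ y
  x∧y≤y x y = ⋁-least _ y (λ _ → proj₂)

  ∧-greatest : ∀ {x y z} → z ≤ x → z ≤ y → z ≤ (x ∧ y)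
  ∧-greatest z≤x z≤y = ⋁-upper _ _ (z≤x , z≤y)

  ∨-least : ∀ {x y z} → x ≤ z → y ≤ z → (x ∨ y) ≤ z
  ∨-least x≤z y≤z = ⋁-least _ _ (λ { _ (inj₁ refl) → x≤z ; _ (inj₂ refl) → y≤z })

  ⋁-image : {A : Set a} → Pred A a → (A → Carrier) → Carrier
  ⋁-image S f = ⋁ (λ z → ∃ λ y → y ∈ S × z ≡ f y)

  syntax ⋁-image S (λ y → e) = ⋁[ y ∈ S ] e

  module _ {A : Set a} {S : Pred A a} where

    ⋁-image-upper : ∀ (f : A → Carrier) {y} → y ∈ S → f y ≤ ⋁-image S f
    ⋁-image-upper f y∈S = ⋁-upper _ _ (_ , y∈S , refl)

    ⋁-image-least : ∀ {f : A → Carrier} {e} → (∀ y → y ∈ S → f y ≤ e) → ⋁-image S f ≤ e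
    ⋁-image-least f≤e = ⋁-least _ _ (λ { _ (y , y∈S , refl) → f≤e y y∈S })

    ⋁-image-cong : ∀ {f g : A → Carrier} → (∀ y → f y ≡ g y) → ⋁-image S f ≡ ⋁-image S g
    ⋁-image-cong {f} {g} f≡g = antisym
      (⋁-image-least (λ y y∈S → ≤-trans (≤-reflexive (f≡g y)) (⋁-image-upper g y∈S)))
      (⋁-image-least (λ y y∈S → ≤-trans (≤-reflexive (sym (f≡g y))) (⋁-image-upper f y∈S)))

  extend-upper : ∀ (U : C → C → C) {x y u v} → u ∈ κ L x → v ∈ κ L y →
                 proj₁ (U u v) ≤ extend L U x y
  extend-upper U {x} {y} {u} {v} u∈κx v∈κy = begin
    proj₁ (U u v)                       ≤⟨ ⋁-image-upper (λ v → proj₁ (U u v)) v∈κy ⟩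
    ⋁[ v′ ∈ κ L y ] proj₁ (U u v′)      ≤⟨ ⋁-image-upper (λ u → ⋁[ v′ ∈ κ L y ] proj₁ (U u v′)) u∈κx ⟩
    extend L U x y                      ∎

  extend-monoʳ : ∀ (U : C → C → C) x {y y′} → y ≤ y′ → extend L U x y ≤ extend L U x y′
  extend-monoʳ U x y≤y′ = ⋁-image-least λ u u∈κx → ⋁-image-least λ v (v≢𝟘 , v≤y) →
    extend-upper U u∈κx (v≢𝟘 , ≤-trans v≤y y≤y′)

  atomC : ∀ {p} → IsAtom p → C
  atomC p-atom = _ , inj₁ p-atom

  atom∈κ : ∀ {p x} (p-atom : IsAtom p) → p ≤ x → atomC p-atom ∈ κ L x
  atom∈κ (_ , p≢𝟘 , _) p≤x = p≢𝟘 , p≤x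

  atom-≤⊎disjoint : ∀ {p} → IsAtom p → ∀ e → (p ≤ e) ⊎ ((p ∧ e) ≡ 𝟘)
  atom-≤⊎disjoint {p} (_ , _ , covers) e with covers (p ∧ e) (𝟘-least _) (x∧y≤x p e)
  ... | inj₁ p∧e≡𝟘 = inj₂ p∧e≡𝟘
  ... | inj₂ p∧e≡p = inj₁ (≤-trans (≤-reflexive (sym p∧e≡p)) (x∧y≤y p e))

  atom-disjoint⇒≰ : ∀ {p e} → IsAtom p → (p ∧ e) ≡ 𝟘 → ¬ p ≤ e
  atom-disjoint⇒≰ (_ , p≢𝟘 , _) p∧e≡𝟘 p≤e =
    p≢𝟘 (≤𝟘⇒≡𝟘 (≤-trans (∧-greatest ≤-refl p≤e) (≤-reflexive p∧e≡𝟘)))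

  module _ (atomistic : IsAtomistic) where

    ≤-stable : ∀ w e → Stable (w ≤ e)
    ≤-stable w e ¬¬w≤e with atomistic w
    ... | S , S-atoms , w≡⋁S = ≤-trans (≤-reflexive w≡⋁S) (⋁-least S e atom≤e)
      where
      atom≤e : ∀ p → p ∈ S → p ≤ e
      atom≤e p p∈S with atom-≤⊎disjoint (S-atoms p p∈S) e
      ... | inj₁ p≤e = p≤e
      ... | inj₂ p∧e≡𝟘 = contradiction
        (λ w≤e → atom-disjoint⇒≰ (S-atoms p p∈S) p∧e≡𝟘
          (≤-trans (⋁-upper S p p∈S) (≤-trans (≤-reflexive (sym w≡⋁S)) w≤e)))
        ¬¬w≤e

    ≤-by-cases : ∀ {ℓ} (P : Set ℓ) {w e} → (P → w ≤ e) → (¬ P → w ≤ e) → w ≤ e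
    ≤-by-cases P if-P if-¬P = ≤-stable _ _
      (¬¬-map (λ { (yes p) → if-P p ; (no ¬p) → if-¬P ¬p }) ¬¬-excluded-middle)

  module _ {T : Carrier → Carrier → Carrier} (T-isTNorm : IsTNormL L T) where
    open IsTNorm T-isTNorm

    T-≤ˡ : ∀ x y → T x y ≤ x
    T-≤ˡ x y = ≤-trans (monoʳ x (𝟙-greatest y)) (≤-reflexive (identityʳ x))

    T-identityˡ : ∀ y → T 𝟙 y ≡ y
    T-identityˡ y = trans (comm 𝟙 y) (identityʳ y)

    T-closed-C : (u v : C) → InC (T (proj₁ u) (proj₁ v))
    T-closed-C (u , inj₁ u-atom@(_ , _ , covers)) (v , _) with covers (T u v) (𝟘-least _) (T-≤ˡ u v)
    ... | inj₁ Tuv≡𝟘 = inj₂ (inj₁ Tuv≡𝟘)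
    ... | inj₂ Tuv≡u = inj₁ (subst IsAtom (sym Tuv≡u) u-atom)
    T-closed-C (u , inj₂ (inj₁ u≡𝟘)) (v , _) =
      inj₂ (inj₁ (≤𝟘⇒≡𝟘 (≤-trans (T-≤ˡ u v) (≤-reflexive u≡𝟘))))
    T-closed-C (u , inj₂ (inj₂ refl)) (v , v∈C) = subst InC (sym (T-identityˡ v)) v∈C

    restrictC : C → C → C
    restrictC u v = T (proj₁ u) (proj₁ v) , T-closed-C u v

    restrictC-isTNorm : IsTNormC L restrictC
    restrictC-isTNorm = record
      { monoˡ     = λ w → monoˡ (proj₁ w)
      ; monoʳ     = λ w → monoʳ (proj₁ w)
      ; comm      = λ u v → comm (proj₁ u) (proj₁ v)
      ; assoc     = λ u v w → assoc (proj₁ u) (proj₁ v) (proj₁ w)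
      ; identityʳ = λ u → identityʳ (proj₁ u)
      }

    extend-restrictC-≤ : ∀ x y → extend L restrictC x y ≤ T x y
    extend-restrictC-≤ x y =
      ⋁-image-least λ u (_ , u≤x) → ⋁-image-least λ v (_ , v≤y) →
        ≤-trans (monoˡ (proj₁ v) u≤x) (monoʳ x v≤y)

    module _ (atomistic : IsAtomistic) (T-lsc : LeftSemicontinuous L T) where

      -- Left-semicontinuity says nothing at y = 𝟙, but then 𝟙 ∈ κ y itself.
      lsc-≤-by-κʳ : ∀ x y {e} → (∀ v → v ∈ κ L y → T x (proj₁ v) ≤ e) → T x y ≤ e
      lsc-≤-by-κʳ x y {e} κ-bound =
        ≤-by-cases atomistic (𝟙 ≡ 𝟘) (λ 𝟙≡𝟘 → 𝟙≡𝟘⇒≤ 𝟙≡𝟘 _ _) λ 𝟙≢𝟘 →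
        ≤-by-cases atomistic (y ≡ 𝟙)
          (λ y≡𝟙 → ≤-trans (monoʳ x (𝟙-greatest y)) (κ-bound 𝟙C (𝟙≢𝟘 , ≤-reflexive (sym y≡𝟙))))
          (λ y≢𝟙 → let S , S-atoms , y≡⋁S = atomistic y in split-into-atoms y≢𝟙 S S-atoms y≡⋁S)
        where
        split-into-atoms : ¬ y ≡ 𝟙 → (S : Pred Carrier a) → (∀ p → p ∈ S → IsAtom p) →
                           y ≡ ⋁ S → T x y ≤ e
        split-into-atoms y≢𝟙 S S-atoms y≡⋁S = begin
          T x y              ≡⟨ cong (T x) y≡⋁S ⟩
          T x (⋁ S)          ≡⟨ T-lsc x S (λ ⋁S≡𝟙 → y≢𝟙 (trans y≡⋁S ⋁S≡𝟙)) ⟩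
          ⋁[ t ∈ S ] T x t   ≤⟨ ⋁-image-least (λ t t∈S → κ-bound (atomC (S-atoms t t∈S)) (S⊆κy t∈S)) ⟩
          e                  ∎
          where
          S⊆κy : ∀ {t} (t∈S : t ∈ S) → atomC (S-atoms t t∈S) ∈ κ L y
          S⊆κy t∈S = atom∈κ (S-atoms _ t∈S) (≤-trans (⋁-upper S _ t∈S) (≤-reflexive (sym y≡⋁S)))

      lsc⇒≡extend-restrictC : ∀ x y → T x y ≡ extend L restrictC x y
      lsc⇒≡extend-restrictC x y = antisym
        (lsc-≤-by-κʳ x y λ v v∈κy →
          ≤-trans (≤-reflexive (comm x (proj₁ v))) (lsc-≤-by-κʳ (proj₁ v) x λ u u∈κx →
            ≤-trans (≤-reflexive (comm (proj₁ v) (proj₁ u)))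
                    (extend-upper restrictC {u = u} {v = v} u∈κx v∈κy)))
        (extend-restrictC-≤ x y)

      lsc⇒In𝔗 : In𝔗 L T
      lsc⇒In𝔗 = restrictC , restrictC-isTNorm , lsc⇒≡extend-restrictC

  module _ (boolean : IsBoolean) where

    disjoint⇒≤-complement : ∀ {p p′ s} → (p ∨ p′) ≡ 𝟙 → (p ∧ s) ≡ 𝟘 → s ≤ p′
    disjoint⇒≤-complement {p} {p′} {s} p∨p′≡𝟙 p∧s≡𝟘 = begin
      s                     ≤⟨ ∧-greatest ≤-refl (≤-trans (𝟙-greatest s) (≤-reflexive (sym p∨p′≡𝟙))) ⟩
      s ∧ (p ∨ p′)          ≡⟨ proj₁ boolean s p p′ ⟩
      (s ∧ p) ∨ (s ∧ p′)    ≤⟨ ∨-least s∧p≤p′ (x∧y≤y s p′) ⟩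
      p′                    ∎
      where
      s∧p≤p′ : (s ∧ p) ≤ p′
      s∧p≤p′ = ≤-trans (∧-greatest (x∧y≤y s p) (x∧y≤x s p))
                       (≤-trans (≤-reflexive p∧s≡𝟘) (𝟘-least p′))

    atom≤⋁⇒¬¬∃≤ : ∀ {p} → IsAtom p → (S : Pred Carrier a) → p ≤ ⋁ S →
                  ¬ ¬ (∃ λ s → s ∈ S × p ≤ s)
    atom≤⋁⇒¬¬∃≤ {p} p-atom S p≤⋁S ∄s with proj₂ boolean p
    ... | p′ , p∧p′≡𝟘 , p∨p′≡𝟙 =
      atom-disjoint⇒≰ p-atom p∧p′≡𝟘 (≤-trans p≤⋁S (⋁-least S p′ member≤p′))
      where
      member≤p′ : ∀ s → s ∈ S → s ≤ p′
      member≤p′ s s∈S with atom-≤⊎disjoint p-atom s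
      ... | inj₁ p≤s    = contradiction (s , s∈S , p≤s) ∄s
      ... | inj₂ p∧s≡𝟘 = disjoint⇒≤-complement p∨p′≡𝟙 p∧s≡𝟘

    module _ (atomistic : IsAtomistic) where

      extend-leftSemicontinuous : ∀ (U : C → C → C) → LeftSemicontinuous L (extend L U)
      extend-leftSemicontinuous U x S ⋁S≢𝟙 = antisym
        (⋁-image-least λ u u∈κx → ⋁-image-least λ v v∈κ⋁S → below-member u∈κx v v∈κ⋁S)
        (⋁-image-least λ s s∈S → extend-monoʳ U x (⋁-upper S s s∈S))
        where
        below-member : ∀ {u} → u ∈ κ L x → ∀ v → v ∈ κ L (⋁ S) →
                       proj₁ (U u v) ≤ (⋁[ s ∈ S ] extend L U x s)
        below-member u∈κx (v , inj₁ v-atom) (_ , v≤⋁S) = ≤-stable atomistic _ _ (¬¬-map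
          (λ (s , s∈S , v≤s) → ≤-trans (extend-upper U u∈κx (atom∈κ v-atom v≤s))
                                       (⋁-image-upper (extend L U x) s∈S))
          (atom≤⋁⇒¬¬∃≤ v-atom S v≤⋁S))
        below-member _ (v , inj₂ (inj₁ v≡𝟘)) (v≢𝟘 , _) = contradiction v≡𝟘 v≢𝟘
        below-member _ (v , inj₂ (inj₂ refl)) (_ , 𝟙≤⋁S) =
          contradiction (antisym (𝟙-greatest _) 𝟙≤⋁S) ⋁S≢𝟙

      In𝔗⇒lsc : ∀ {T} → In𝔗 L T → LeftSemicontinuous L T
      In𝔗⇒lsc {T} (U , _ , T≡extend) x S ⋁S≢𝟙 = begin-equality
        T x (⋁ S)                    ≡⟨ T≡extend x (⋁ S) ⟩
        extend L U x (⋁ S)           ≡⟨ extend-leftSemicontinuous U x S ⋁S≢𝟙 ⟩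
        ⋁[ s ∈ S ] extend L U x s    ≡⟨ ⋁-image-cong (λ s → sym (T≡extend x s)) ⟩
        ⋁[ s ∈ S ] T x s             ∎

corollary4p4 : {a : Level} (L : CompleteLattice a) →
    CompleteLattice.IsBoolean L → CompleteLattice.IsAtomistic L →
    (T : CompleteLattice.Carrier L → CompleteLattice.Carrier L → CompleteLattice.Carrier L) →
    IsTNormL L T →
    (LeftSemicontinuous L T ⇔ In𝔗 L T)
corollary4p4 L boolean atomistic T T-isTNorm =
  mk⇔ (lsc⇒In𝔗 L T-isTNorm atomistic) (In𝔗⇒lsc L boolean atomistic)
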